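{- Let $n$ be a positive integer, let $r = \mathsf{sr}(n)$, and let $y_1 = n, y_2, \ldots, y_r$ be integers. Then $\mathsf{Alist}_n$ is $\langle 1,y_1\rangle \to \langle 2,y_2\rangle \to \cdots \to \langle r,y_r\rangle$ (with $y_r = r$) if and only if the numbers $w_i = y_i - y_{i+1} + 1$ satisfy $$w_i = \left\lceil \frac{n-1-(w_1+\cdots+w_{i-1})}{i+1}\right\rceil$$ for all $i = 1,2,\ldots,r-1$ (the sum $w_1+\cdots+w_{i-1}$ being $0$ when $i=1$).
   Context: For $n \in \{1,2,\ldots\}$, $\mathsf{Alist}_n$ is the sequence of integer pairs produced as follows: begin with $\langle 1, n\rangle$. Given the current pair $\langle i, y_i\rangle$ with $y_i > i$, the next pair is $\langle i+1, y_{i+1}\rangle$, where $y_{i+1}$ is the smallest integer with $(i+1)y_{i+1} > i(y_i+1)$. Stop when the current pair $\langle i,y_i\rangle$ satisfies $y_i \leq i$. This process always terminates; its final pair is denoted $\langle \mathsf{sr}(n), y_{\mathsf{sr}(n)}\rangle$, $\mathsf{sr}(n)$ is called the strange root of $n$, and $y_{\mathsf{sr}(n)} = \mathsf{sr}(n)$. -}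

module Defs where

open import Data.Nat as ℕ using (ℕ; zero; suc; _≤?_)
open import Data.Integer as ℤ using (ℤ; +_; -_; _/ℕ_)
open import Data.List using (List; []; _∷_; length)
open import Data.Product using (_×_; _,_)
open import Relation.Nullary using (yes; no)

-- One step of the Alist process: from ⟨i, y⟩ (with i ≥ 1) the next second
-- coordinate is the smallest integer y' with (i+1) y' > i (y+1),
-- namely  ⌊ i (y+1) / (i+1) ⌋ + 1.
next : ℕ → ℕ → ℕ
next i y = (i ℕ.* (y ℕ.+ 1)) ℕ./ suc i ℕ.+ 1

alistFrom : ℕ → ℕ → ℕ → List (ℕ × ℕ)
alistFrom zero    i y = []
alistFrom (suc f) i y with y ≤? i
... | yes _ = (i , y) ∷ []
... | no  _ = (i , y) ∷ alistFrom f (suc i) (next i y)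

-- Fuel suc n is ample: the index i starts at 1,
-- increases by one each step, y is non-increasing from n, and the process
-- stops once y ≤ i, so at most n pairs are ever produced (for n ≥ 1).
Alist : ℕ → List (ℕ × ℕ)
Alist n = alistFrom (suc n) 1 n

-- The strange root: the index of the final pair.  Since the pairs of Alist_n
-- have first coordinates 1, 2, …, the final index equals the length.
sr : ℕ → ℕ
sr n = length (Alist n)

pairsUpTo : (ℕ → ℤ) → ℕ → List (ℕ × ℤ)
pairsUpTo y r = go 1 r
  where
  go : ℕ → ℕ → List (ℕ × ℤ)
  go i zero    = []
  go i (suc k) = (i , y i) ∷ go (suc i) k

toℤpairs : List (ℕ × ℕ) → List (ℕ × ℤ)
toℤpairs []             = []
toℤpairs ((i , v) ∷ ps) = (i , + v) ∷ toℤpairs ps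

sumTo : (ℕ → ℤ) → ℕ → ℤ
sumTo f zero    = + 0
sumTo f (suc k) = sumTo f k ℤ.+ f (suc k)

ceilDiv : ℤ → (d : ℕ) → .{{ℕ.NonZero d}} → ℤ
ceilDiv a d = - ((- a) /ℕ d)

-- Telescoping turns the argument of the i-th ceiling into y_i − i, so the
-- i-th condition says exactly y_{i+1} = y_i + 1 − ⌈(y_i − i)/(i+1)⌉.  Since
-- i(y+1) = (i − y) + y(i+1), the Alist step ⌊i(y+1)/(i+1)⌋ + 1 equals
-- y + 1 + ⌊(i − y)/(i+1)⌋ = y + 1 − ⌈(y − i)/(i+1)⌉, the same recursion.
-- Hence both sides say that y follows the Alist recursion up to index sr(n).
module Submission where

open import Defs
open import Data.Nat using (ℕ; suc; _≤_; _<_; _∸_)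
open import Data.Integer using (ℤ; +_; _+_; _-_)
open import Relation.Binary.PropositionalEquality using (_≡_)
open import Function.Bundles using (_⇔_)

open import Data.Nat as ℕ using (zero; s≤s; _≤?_)
import Data.Nat.Properties as ℕ
open import Data.Integer as ℤ using (-_; _*_; _/ℕ_) renaming (suc to sucℤ)
import Data.Integer.Properties as ℤ
open import Data.Integer.DivMod using ([n/ℕd]*d≤n; n<s[n/ℕd]*d)
open import Data.Integer.Solver using (module +-*-Solver)
open +-*-Solver using (solve; _:+_; _:-_; _:*_; :-_; _:=_; con)
open import Data.List using (List; []; _∷_; length)
open import Data.List.Properties using (∷-injective)
open import Data.Product using (_×_; _,_; proj₁; proj₂)
open import Data.Sum using (_⊎_; inj₁; inj₂)
open import Data.Empty using (⊥-elim)
open import Relation.Nullary using (yes; no)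
open import Relation.Binary.PropositionalEquality
  using (refl; sym; trans; cong; cong₂; subst; module ≡-Reasoning)
open import Function.Bundles using (mk⇔; Equivalence)

/ℕ-unique : ∀ a d .{{_ : ℕ.NonZero d}} q →
            q * + d ℤ.≤ a → a ℤ.< sucℤ q * + d → a /ℕ d ≡ q
/ℕ-unique a d q lower upper = ℤ.≤-antisym ⌊a/d⌋≤q q≤⌊a/d⌋
  where
  q≤⌊a/d⌋ : q ℤ.≤ a /ℕ d
  q≤⌊a/d⌋ = subst (q ℤ.≤_) (ℤ.pred-suc (a /ℕ d))
    (ℤ.i<j⇒i≤pred[j] (ℤ.*-cancelʳ-<-nonNeg {q} {sucℤ (a /ℕ d)} (+ d)
      (ℤ.≤-<-trans lower (n<s[n/ℕd]*d a d))))
  ⌊a/d⌋≤q : a /ℕ d ℤ.≤ q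
  ⌊a/d⌋≤q = subst (a /ℕ d ℤ.≤_) (ℤ.pred-suc q)
    (ℤ.i<j⇒i≤pred[j] (ℤ.*-cancelʳ-<-nonNeg {a /ℕ d} {sucℤ q} (+ d)
      (ℤ.≤-<-trans ([n/ℕd]*d≤n a d) upper)))

[a+b*d]/ℕd≡a/ℕd+b : ∀ a b d .{{_ : ℕ.NonZero d}} →
                    (a + b * + d) /ℕ d ≡ a /ℕ d + b
[a+b*d]/ℕd≡a/ℕd+b a b d = /ℕ-unique (a + b * + d) d (a /ℕ d + b) lower upper
  where
  open ℤ.≤-Reasoning
  lower : (a /ℕ d + b) * + d ℤ.≤ a + b * + d
  lower = begin
    (a /ℕ d + b) * + d       ≡⟨ ℤ.*-distribʳ-+ (+ d) (a /ℕ d) b ⟩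
    a /ℕ d * + d + b * + d   ≤⟨ ℤ.+-monoˡ-≤ (b * + d) ([n/ℕd]*d≤n a d) ⟩
    a + b * + d              ∎
  upper : a + b * + d ℤ.< sucℤ (a /ℕ d + b) * + d
  upper = begin-strict
    a + b * + d                   <⟨ ℤ.+-monoˡ-< (b * + d) (n<s[n/ℕd]*d a d) ⟩
    sucℤ (a /ℕ d) * + d + b * + d ≡⟨ ℤ.*-distribʳ-+ (+ d) (sucℤ (a /ℕ d)) b ⟨
    (sucℤ (a /ℕ d) + b) * + d     ≡⟨ cong (_* + d) (ℤ.+-assoc (+ 1) (a /ℕ d) b) ⟩
    sucℤ (a /ℕ d + b) * + d       ∎

next-as-ceilDiv : ∀ i v → + next i v ≡ + v + + 1 - ceilDiv (+ v - + i) (suc i)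
next-as-ceilDiv i v = begin
  + (i ℕ.* (v ℕ.+ 1)) /ℕ suc i + + 1                ≡⟨ cong (λ t → t /ℕ suc i + + 1) split ⟩
  (+ i - + v + + v * + suc i) /ℕ suc i + + 1        ≡⟨ cong (_+ + 1) ([a+b*d]/ℕd≡a/ℕd+b (+ i - + v) (+ v) (suc i)) ⟩
  (+ i - + v) /ℕ suc i + + v + + 1                  ≡⟨ shuffle ((+ i - + v) /ℕ suc i) (+ v) ⟩
  + v + + 1 - - ((+ i - + v) /ℕ suc i)              ≡⟨ cong (λ t → + v + + 1 - - (t /ℕ suc i)) (swap (+ v) (+ i)) ⟨
  + v + + 1 - - ((- (+ v - + i)) /ℕ suc i)          ∎
  where
  open ≡-Reasoning
  split : + (i ℕ.* (v ℕ.+ 1)) ≡ + i - + v + + v * (+ 1 + + i)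
  split = trans (ℤ.pos-* i (v ℕ.+ 1))
    (solve 2 (λ i v → i :* (v :+ con (+ 1)) := i :- v :+ v :* (con (+ 1) :+ i)) refl (+ i) (+ v))
  shuffle : ∀ c v → c + v + + 1 ≡ v + + 1 - - c
  shuffle = solve 2 (λ c v → c :+ v :+ con (+ 1) := v :+ con (+ 1) :- (:- c)) refl
  swap : ∀ v i → - (v - i) ≡ i - v
  swap = solve 2 (λ v i → :- (v :- i) := i :- v) refl

b≡a+1-c⇔a-b+1≡c : ∀ a b c → b ≡ a + + 1 - c ⇔ a - b + + 1 ≡ c
b≡a+1-c⇔a-b+1≡c a b c = mk⇔
  (λ b≡ → trans (cong (λ t → a - t + + 1) b≡) (cancel a c))
  (λ ≡c → trans (recover a b) (cong (λ t → a + + 1 - t) ≡c))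
  where
  cancel : ∀ a c → a - (a + + 1 - c) + + 1 ≡ c
  cancel = solve 2 (λ a c → a :- (a :+ con (+ 1) :- c) :+ con (+ 1) := c) refl
  recover : ∀ a b → b ≡ a + + 1 - (a - b + + 1)
  recover = solve 2 (λ a b → b := a :+ con (+ 1) :- (a :- b :+ con (+ 1))) refl

w : (ℕ → ℤ) → ℕ → ℤ
w y j = y j - y (suc j) + + 1

sumTo-w : ∀ y k → sumTo (w y) k ≡ y 1 - y (suc k) + + k
sumTo-w y zero    = solve 1 (λ a → con (+ 0) := a :- a :+ con (+ 0)) refl (y 1)
sumTo-w y (suc k) = trans (cong (_+ w y (suc k)) (sumTo-w y k))
  (solve 4 (λ a b c k → a :- b :+ k :+ (b :- c :+ con (+ 1)) := a :- c :+ (con (+ 1) :+ k))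
     refl (y 1) (y (suc k)) (y (suc (suc k))) (+ k))

ceilDiv-argument : ∀ n y → y 1 ≡ + n → ∀ i → 1 ≤ i →
                   + n - + 1 - sumTo (w y) (i ∸ 1) ≡ y i - + i
ceilDiv-argument n y y₁ (suc i) _ = begin
  + n - + 1 - sumTo (w y) i            ≡⟨ cong (λ t → + n - + 1 - t) (sumTo-w y i) ⟩
  + n - + 1 - (y 1 - y (suc i) + + i)  ≡⟨ cong (λ t → + n - + 1 - (t - y (suc i) + + i)) y₁ ⟩
  + n - + 1 - (+ n - y (suc i) + + i)  ≡⟨ solve 3 (λ n a i → n :- con (+ 1) :- (n :- a :+ i) := a :- (con (+ 1) :+ i))
                                            refl (+ n) (y (suc i)) (+ i) ⟩
  y (suc i) - + suc i                  ∎
  where open ≡-Reasoning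

pairsFrom : (ℕ → ℤ) → ℕ → ℕ → List (ℕ × ℤ)
pairsFrom y i zero    = []
pairsFrom y i (suc k) = (i , y i) ∷ pairsFrom y (suc i) k

-- The local helper of pairsUpTo is not in scope, so it is named through a
-- metavariable: with-abstracting its arguments in pairsUpTo-suc makes the
-- only solution the helper itself.
mutual
  pairsUpToHelper : (ℕ → ℤ) → ℕ → ℕ → ℕ → List (ℕ × ℤ)
  pairsUpToHelper = _

  pairsUpTo-suc : ∀ y k → pairsUpTo y (suc k) ≡ (1 , y 1) ∷ pairsUpToHelper y (suc k) 2 k
  pairsUpTo-suc y k with suc k | 2
  ... | r | i = refl

pairsUpToHelper≡pairsFrom : ∀ y r i k → pairsUpToHelper y r i k ≡ pairsFrom y i k
pairsUpToHelper≡pairsFrom y r i zero    = refl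
pairsUpToHelper≡pairsFrom y r i (suc k) = cong ((i , y i) ∷_) (pairsUpToHelper≡pairsFrom y r (suc i) k)

pairsUpTo≡pairsFrom : ∀ y r → pairsUpTo y r ≡ pairsFrom y 1 r
pairsUpTo≡pairsFrom y zero    = refl
pairsUpTo≡pairsFrom y (suc k) =
  trans (pairsUpTo-suc y k) (cong ((1 , y 1) ∷_) (pairsUpToHelper≡pairsFrom y (suc k) 2 k))

toℤpairs-∷ : ∀ y i v ps k →
             toℤpairs ((i , v) ∷ ps) ≡ pairsFrom y i (suc k) ⇔
             (+ v ≡ y i × toℤpairs ps ≡ pairsFrom y (suc i) k)
toℤpairs-∷ y i v ps k = mk⇔
  (λ eq → let head , tail = ∷-injective eq in cong proj₂ head , tail)
  (λ (head , tail) → cong₂ _∷_ (cong (i ,_) head) tail)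

alistFrom-nonempty : ∀ f i v → 1 ≤ length (alistFrom (suc f) i v)
alistFrom-nonempty f i v with v ≤? i
... | yes _ = s≤s ℕ.z≤n
... | no  _ = s≤s ℕ.z≤n

module _ (y : ℕ → ℤ) where

  Recurrence : ℕ → Set
  Recurrence j = w y j ≡ ceilDiv (y j - + j) (suc j)

  -- j ranges over [i, i + k − 1): the last of the k pairs has no successor.
  Recurrences : ℕ → ℕ → Set
  Recurrences i k = ∀ j → i ≤ j → suc j < i ℕ.+ k → Recurrence j

  next-step : ∀ {j v} → y j ≡ + v → y (suc j) ≡ + next j v ⇔ Recurrence j
  next-step {j} {v} yj = subst (λ t → y (suc j) ≡ t ⇔ Recurrence j) step
    (b≡a+1-c⇔a-b+1≡c (y j) (y (suc j)) (ceilDiv (y j - + j) (suc j)))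
    where
    step : y j + + 1 - ceilDiv (y j - + j) (suc j) ≡ + next j v
    step = trans (cong (λ t → t + + 1 - ceilDiv (t - + j) (suc j)) yj) (sym (next-as-ceilDiv j v))

  recurrences-1 : ∀ i → Recurrences i 1
  recurrences-1 i j i≤j sj<i+1 =
    ⊥-elim (ℕ.<⇒≱ (ℕ.≤-pred (subst (suc j <_) (ℕ.+-comm i 1) sj<i+1)) i≤j)

  recurrences-∷ : ∀ {i k} → 1 ≤ k → Recurrences i (suc k) ⇔ (Recurrence i × Recurrences (suc i) k)
  recurrences-∷ {i} {k} 1≤k = mk⇔
    (λ rs → rs i ℕ.≤-refl (shift (s≤s (ℕ.m<m+n i 1≤k))) ,
            λ j i<j sj< → rs j (ℕ.<⇒≤ i<j) (shift sj<))
    (λ (r , rs) j i≤j sj< → case-split r rs j (ℕ.m≤n⇒m<n∨m≡n i≤j) sj<)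
    where
    shift : ∀ {m} → m < suc i ℕ.+ k → m < i ℕ.+ suc k
    shift {m} = subst (m <_) (sym (ℕ.+-suc i k))
    case-split : Recurrence i → Recurrences (suc i) k →
                 ∀ j → i < j ⊎ i ≡ j → suc j < i ℕ.+ suc k → Recurrence j
    case-split r rs j (inj₁ i<j) sj< = rs j i<j (subst (suc j <_) (ℕ.+-suc i k) sj<)
    case-split r rs j (inj₂ refl) _  = r

  singleton-spec : ∀ i v → toℤpairs ((i , v) ∷ []) ≡ pairsFrom y i 1 ⇔ (y i ≡ + v × Recurrences i 1)
  singleton-spec i v = mk⇔
    (λ eq → sym (proj₁ (Equivalence.to (toℤpairs-∷ y i v [] 0) eq)) , recurrences-1 i)
    (λ (yi , _) → cong (λ t → (i , t) ∷ []) (sym yi))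

  alistFrom-spec : ∀ f i v →
    toℤpairs (alistFrom (suc f) i v) ≡ pairsFrom y i (length (alistFrom (suc f) i v))
      ⇔ (y i ≡ + v × Recurrences i (length (alistFrom (suc f) i v)))
  alistFrom-spec f i v with v ≤? i
  alistFrom-spec f       i v | yes _ = singleton-spec i v
  alistFrom-spec zero    i v | no  _ = singleton-spec i v
  alistFrom-spec (suc f) i v | no  _ = mk⇔ to from
    where
    ps = alistFrom (suc f) (suc i) (next i v)
    module IH = Equivalence (alistFrom-spec f (suc i) (next i v))
    module Cons = Equivalence (toℤpairs-∷ y i v ps (length ps))
    module Rec = Equivalence (recurrences-∷ {i} (alistFrom-nonempty f (suc i) (next i v)))
    to : toℤpairs ((i , v) ∷ ps) ≡ pairsFrom y i (suc (length ps)) →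
         y i ≡ + v × Recurrences i (suc (length ps))
    to eq with Cons.to eq
    ... | v≡yi , tail with IH.to tail
    ...   | y≡next , rs = sym v≡yi , Rec.from (Equivalence.to (next-step (sym v≡yi)) y≡next , rs)
    from : y i ≡ + v × Recurrences i (suc (length ps)) →
           toℤpairs ((i , v) ∷ ps) ≡ pairsFrom y i (suc (length ps))
    from (yi , rs′) with Rec.to rs′
    ... | r , rs = Cons.from (sym yi , IH.from (Equivalence.from (next-step yi) r , rs))

proposition2p5 : (n : ℕ) → 1 ≤ n → (y : ℕ → ℤ) → y 1 ≡ + n →
    (toℤpairs (Alist n) ≡ pairsUpTo y (sr n))
      ⇔ (∀ i → 1 ≤ i → i < sr n →
           (y i - y (suc i) + + 1)
             ≡ ceilDiv (+ n - + 1 - sumTo (λ j → y j - y (suc j) + + 1) (i ∸ 1)) (suc i))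
proposition2p5 n _ y y₁ = mk⇔
  (λ eq i 1≤i i<r → trans (proj₂ (Spec.to (trans eq (pairsUpTo≡pairsFrom y (sr n)))) i 1≤i (s≤s i<r))
                          (cong (λ t → ceilDiv t (suc i)) (sym (ceilDiv-argument n y y₁ i 1≤i))))
  (λ conds → trans (Spec.from (y₁ , λ i 1≤i si<1+r →
                      trans (conds i 1≤i (ℕ.≤-pred si<1+r))
                            (cong (λ t → ceilDiv t (suc i)) (ceilDiv-argument n y y₁ i 1≤i))))
                   (sym (pairsUpTo≡pairsFrom y (sr n))))
  where
  module Spec = Equivalence (alistFrom-spec y n 1 n)
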